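{- Let $t\geq 2$ and $n\geq 1$ be integers and let $W_{n+1}^{t}$ be the windmill graph, obtained from $t$ copies of $K_{n+1}$ by identifying one vertex from each copy into a single common vertex. Then its Kemeny's constant is $$\kappa(W_{n+1}^{t})= \frac{n^2(2t-1)}{n+1}.$$
   Context: For a connected graph $G$ with $m$ edges and vertices $v_1,\dots,v_N$ of degrees $d_1,\dots,d_N$, the resistance distance $r_{ij}$ is the effective resistance between $v_i$ and $v_j$ when every edge is a resistor of $1\Omega$ (equivalently $r_{ij}=l^{\#}_{ii}+l^{\#}_{jj}-2l^{\#}_{ij}$ with $L^{\#}$ the group inverse of the Laplacian $L=D-A$), and Kemeny's constant is $\kappa(G)=\frac{1}{4m}\sum_{v_i,v_j\in V(G)} d_i d_j r_{ij}$, the sum running over all ordered pairs $(v_i,v_j)\in V(G)\times V(G)$. -}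

module Defs where

open import Data.Bool using (Bool; true; false; _∧_; not; if_then_else_)
open import Data.Nat as ℕ using (ℕ; zero; suc)
open import Data.Fin as Fin using (Fin; zero; suc; quotient; _<?_)
open import Data.Integer using (+_)
open import Data.Rational using (ℚ; 0ℚ; 1ℚ; _+_; _*_; _-_; _/_)
open import Relation.Nullary.Decidable using (⌊_⌋)
open import Relation.Binary.PropositionalEquality using (_≡_)

Graph : ℕ → Set
Graph N = Fin N → Fin N → Bool

Matrix : ℕ → Set
Matrix N = Fin N → Fin N → ℚ

∑ℚ : ∀ {N} → (Fin N → ℚ) → ℚ
∑ℚ {zero}  f = 0ℚ
∑ℚ {suc N} f = f zero + ∑ℚ (λ i → f (suc i))

∑ℕ : ∀ {N} → (Fin N → ℕ) → ℕ
∑ℕ {zero}  f = 0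
∑ℕ {suc N} f = f zero ℕ.+ ∑ℕ (λ i → f (suc i))

[_]ℕ : Bool → ℕ
[ true ]ℕ  = 1
[ false ]ℕ = 0

_==_ : ∀ {N} → Fin N → Fin N → Bool
i == j = ⌊ i Fin.≟ j ⌋

degree : ∀ {N} → Graph N → Fin N → ℕ
degree G i = ∑ℕ (λ j → [ G i j ]ℕ)

numEdges : ∀ {N} → Graph N → ℕ
numEdges G = ∑ℕ (λ i → ∑ℕ (λ j → [ ⌊ i <? j ⌋ ∧ G i j ]ℕ))

ℕtoℚ : ℕ → ℚ
ℕtoℚ k = + k / 1

_⊗_ : ∀ {N} → Matrix N → Matrix N → Matrix N
(M ⊗ P) i j = ∑ℚ (λ k → M i k * P k j)

_≐_ : ∀ {N} → Matrix N → Matrix N → Set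
M ≐ P = ∀ i j → M i j ≡ P i j

laplacian : ∀ {N} → Graph N → Matrix N
laplacian G i j =
  (if i == j then ℕtoℚ (degree G i) else 0ℚ) - (if G i j then 1ℚ else 0ℚ)

IsGroupInverse : ∀ {N} → Matrix N → Matrix N → Set
IsGroupInverse L X = (((L ⊗ X) ⊗ L) ≐ L) × ((((X ⊗ L) ⊗ X) ≐ X) × ((L ⊗ X) ≐ (X ⊗ L)))
  where open import Data.Product using (_×_)

resistance : ∀ {N} → Matrix N → Fin N → Fin N → ℚ
resistance X i j = X i i + X j j - (ℕtoℚ 2 * X i j)

-- 1/k for k ≠ 0 (k = 0 never occurs for a connected graph with an edge)
recipℕ : ℕ → ℚ
recipℕ zero    = 0ℚ
recipℕ (suc k) = + 1 / suc k

kemeny : ∀ {N} → Graph N → Matrix N → ℚ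
kemeny G X = recipℕ (4 ℕ.* numEdges G) *
  ∑ℚ (λ i → ∑ℚ (λ j →
     ℕtoℚ (degree G i) * ℕtoℚ (degree G j) * resistance X i j))

-- Windmill graph W^t_{n+1}: vertex 0 is the common (centre) vertex, and
-- vertex suc a (a : Fin (t * n)) is a non-central vertex of copy
-- quotient n a ∈ Fin t.
windmill : (t n : ℕ) → Graph (suc (t ℕ.* n))
windmill t n zero    zero    = false
windmill t n zero    (suc _) = true
windmill t n (suc _) zero    = true
windmill t n (suc a) (suc b) = (quotient {t} n a == quotient {t} n b) ∧ not (a == b)

{-# OPTIONS --safe #-}
module Submission where

-- The windmill is invariant under permuting the vertices of a blade and permuting the blades, so
-- every matrix in the argument (adjacency, Laplacian, group inverse, resistances weighted by
-- degrees) is determined by six numbers: its centre entry, its constant first row and column,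
-- and a blade block c J + d B + e I, where B indicates lying in the same blade. Such matrices
-- multiply by explicit polynomial formulas in these coefficients, so checking that
-- X = (L + s J)⁻¹ − s J with s = 1/(tn+1) is the group inverse of L, and evaluating κ, reduce
-- to identities between rationals using s (tn+1) = 1 and p (n+1) = 1 with p = 1/(n+1).
-- The resistances are 2p from the centre and 2p or 4p between two blade vertices in the same or
-- in different blades; weighting them by the degrees tn and n and dividing by 4m = 2tn(n+1)
-- gives κ = n²(2t−1)/(n+1). Group inverses are unique, so κ does not depend on the choice of X.

open import Defs
open import Data.Bool using (Bool; true; false; _∧_; not; if_then_else_)
open import Data.Empty using (⊥-elim)
open import Data.Fin as Fin using (Fin; zero; suc; quotient; combine; _↑ˡ_; _↑ʳ_; _<?_)
import Data.Fin.Properties as Finₚ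
open import Data.Integer as ℤ using (+_)
import Data.Integer.Properties as ℤₚ
open import Data.Maybe using (Maybe; just; nothing)
open import Data.Nat as ℕ using (ℕ; zero; suc; NonZero; _≤_)
import Data.Nat.Properties as ℕₚ
open import Data.Product using (Σ-syntax; _×_; _,_; proj₁)
open import Data.Rational using (ℚ; 0ℚ; 1ℚ; _+_; _*_; _-_; -_; _/_; toℚᵘ)
open import Data.Rational.Properties
  using (toℚᵘ-injective; toℚᵘ-fromℚᵘ; toℚᵘ-homo-+; toℚᵘ-homo-*; +-*-commutativeRing)
import Data.Rational.Properties as ℚₚ
import Data.Rational.Unnormalised as ℚᵘ
import Data.Rational.Unnormalised.Properties as ℚᵘₚ
open import Function using (_∘_; mk⇔)
open import Relation.Binary.Bundles using (Setoid)
open import Relation.Binary.Definitions using (tri<; tri≈; tri>)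
open import Relation.Binary.PropositionalEquality
open import Relation.Nullary using (yes; no)
open import Relation.Nullary.Decidable using (⌊_⌋; isYes≗does; dec-true; does-⇔)
open import Tactic.RingSolver using (solve-∀)
open import Tactic.RingSolver.Core.AlmostCommutativeRing
  using (AlmostCommutativeRing; fromCommutativeRing)

ℚ-ring : AlmostCommutativeRing _ _
ℚ-ring = fromCommutativeRing +-*-commutativeRing isZero?
  where
  isZero? : ∀ x → Maybe (0ℚ ≡ x)
  isZero? x with 0ℚ ℚₚ.≟ x
  ... | yes p = just p
  ... | no _  = nothing

≡-modulo : ∀ {x y R : ℚ} (k : ℚ) → R ≡ 1ℚ → x ≡ y + k * (R - 1ℚ) → x ≡ y
≡-modulo {y = y} k refl x≡ = trans x≡ (cancel y k)
  where
  cancel : ∀ y k → y + k * (1ℚ - 1ℚ) ≡ y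
  cancel = solve-∀ ℚ-ring

≡-modulo₂ : ∀ {x y R S : ℚ} (k l : ℚ) → R ≡ 1ℚ → S ≡ 1ℚ →
            x ≡ y + k * (R - 1ℚ) + l * (S - 1ℚ) → x ≡ y
≡-modulo₂ {y = y} k l refl refl x≡ = trans x≡ (cancel y k l)
  where
  cancel : ∀ y k l → y + k * (1ℚ - 1ℚ) + l * (1ℚ - 1ℚ) ≡ y
  cancel = solve-∀ ℚ-ring

-- Natural numbers in ℚ

toℚᵘ-/ : ∀ i d → toℚᵘ (i / suc d) ℚᵘ.≃ ℚᵘ.mkℚᵘ i d
toℚᵘ-/ i d = toℚᵘ-fromℚᵘ (ℚᵘ.mkℚᵘ i d)

toℚᵘ-ℕtoℚ : ∀ k → toℚᵘ (ℕtoℚ k) ℚᵘ.≃ ℚᵘ.mkℚᵘ (+ k) 0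
toℚᵘ-ℕtoℚ k = toℚᵘ-/ (+ k) 0

ℕtoℚ-+ : ∀ a b → ℕtoℚ (a ℕ.+ b) ≡ ℕtoℚ a + ℕtoℚ b
ℕtoℚ-+ a b = toℚᵘ-injective (begin
  toℚᵘ (ℕtoℚ (a ℕ.+ b))                   ≈⟨ toℚᵘ-ℕtoℚ (a ℕ.+ b) ⟩
  ℚᵘ.mkℚᵘ (+ (a ℕ.+ b)) 0                 ≈⟨ ℚᵘ.*≡* (cong (ℤ._* + 1) (sym numerators)) ⟩
  ℚᵘ.mkℚᵘ (+ a) 0 ℚᵘ.+ ℚᵘ.mkℚᵘ (+ b) 0    ≈⟨ ℚᵘₚ.+-cong (toℚᵘ-ℕtoℚ a) (toℚᵘ-ℕtoℚ b) ⟨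
  toℚᵘ (ℕtoℚ a) ℚᵘ.+ toℚᵘ (ℕtoℚ b)        ≈⟨ toℚᵘ-homo-+ (ℕtoℚ a) (ℕtoℚ b) ⟨
  toℚᵘ (ℕtoℚ a + ℕtoℚ b)                  ∎)
  where
  open ℚᵘₚ.≃-Reasoning
  numerators : + a ℤ.* + 1 ℤ.+ + b ℤ.* + 1 ≡ + (a ℕ.+ b)
  numerators = trans (cong₂ ℤ._+_ (ℤₚ.*-identityʳ (+ a)) (ℤₚ.*-identityʳ (+ b))) (sym (ℤₚ.pos-+ a b))

ℕtoℚ-* : ∀ a b → ℕtoℚ (a ℕ.* b) ≡ ℕtoℚ a * ℕtoℚ b
ℕtoℚ-* a b = toℚᵘ-injective (begin
  toℚᵘ (ℕtoℚ (a ℕ.* b))                   ≈⟨ toℚᵘ-ℕtoℚ (a ℕ.* b) ⟩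
  ℚᵘ.mkℚᵘ (+ (a ℕ.* b)) 0                 ≈⟨ ℚᵘ.*≡* (cong (ℤ._* + 1) (ℤₚ.pos-* a b)) ⟩
  ℚᵘ.mkℚᵘ (+ a) 0 ℚᵘ.* ℚᵘ.mkℚᵘ (+ b) 0    ≈⟨ ℚᵘₚ.*-cong (toℚᵘ-ℕtoℚ a) (toℚᵘ-ℕtoℚ b) ⟨
  toℚᵘ (ℕtoℚ a) ℚᵘ.* toℚᵘ (ℕtoℚ b)        ≈⟨ toℚᵘ-homo-* (ℕtoℚ a) (ℕtoℚ b) ⟨
  toℚᵘ (ℕtoℚ a * ℕtoℚ b)                  ∎)
  where open ℚᵘₚ.≃-Reasoning

ℕtoℚ-injective : ∀ {a b} → ℕtoℚ a ≡ ℕtoℚ b → a ≡ b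
ℕtoℚ-injective {a} {b} a≡b = ℤₚ.+-injective (begin
  + a            ≡⟨ ℤₚ.*-identityʳ (+ a) ⟨
  + a ℤ.* + 1    ≡⟨ ℚᵘₚ.drop-*≡* a≃b ⟩
  + b ℤ.* + 1    ≡⟨ ℤₚ.*-identityʳ (+ b) ⟩
  + b            ∎)
  where
  open ≡-Reasoning
  a≃b : ℚᵘ.mkℚᵘ (+ a) 0 ℚᵘ.≃ ℚᵘ.mkℚᵘ (+ b) 0
  a≃b = ℚᵘₚ.≃-trans (ℚᵘₚ.≃-sym (toℚᵘ-ℕtoℚ a))
                    (subst (λ q → toℚᵘ q ℚᵘ.≃ ℚᵘ.mkℚᵘ (+ b) 0) (sym a≡b) (toℚᵘ-ℕtoℚ b))

recipℕ-inverse : ∀ k .{{_ : NonZero k}} → recipℕ k * ℕtoℚ k ≡ 1ℚ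
recipℕ-inverse (suc k) = toℚᵘ-injective (begin
  toℚᵘ (recipℕ (suc k) * ℕtoℚ (suc k))              ≈⟨ toℚᵘ-homo-* (recipℕ (suc k)) (ℕtoℚ (suc k)) ⟩
  toℚᵘ (recipℕ (suc k)) ℚᵘ.* toℚᵘ (ℕtoℚ (suc k))    ≈⟨ ℚᵘₚ.*-cong (toℚᵘ-/ (+ 1) k) (toℚᵘ-ℕtoℚ (suc k)) ⟩
  ℚᵘ.mkℚᵘ (+ 1) k ℚᵘ.* ℚᵘ.mkℚᵘ (+ suc k) 0          ≈⟨ ℚᵘ.*≡* (cong (λ z → + suc z) k+0≡k*1+0) ⟩
  toℚᵘ 1ℚ                                            ∎)
  where
  open ℚᵘₚ.≃-Reasoning
  k+0≡k*1+0 : (k ℕ.+ 0) ℕ.* 1 ≡ k ℕ.* 1 ℕ.+ 0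
  k+0≡k*1+0 = trans (cong (ℕ._* 1) (ℕₚ.+-identityʳ k)) (sym (ℕₚ.+-identityʳ (k ℕ.* 1)))

/-as-recipℕ : ∀ a d → + a / suc d ≡ ℕtoℚ a * recipℕ (suc d)
/-as-recipℕ a d = toℚᵘ-injective (begin
  toℚᵘ (+ a / suc d)                             ≈⟨ toℚᵘ-/ (+ a) d ⟩
  ℚᵘ.mkℚᵘ (+ a) d                                ≈⟨ ℚᵘ.*≡* cross ⟩
  ℚᵘ.mkℚᵘ (+ a) 0 ℚᵘ.* ℚᵘ.mkℚᵘ (+ 1) d           ≈⟨ ℚᵘₚ.*-cong (toℚᵘ-ℕtoℚ a) (toℚᵘ-/ (+ 1) d) ⟨
  toℚᵘ (ℕtoℚ a) ℚᵘ.* toℚᵘ (recipℕ (suc d))       ≈⟨ toℚᵘ-homo-* (ℕtoℚ a) (recipℕ (suc d)) ⟨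
  toℚᵘ (ℕtoℚ a * recipℕ (suc d))                 ∎)
  where
  open ℚᵘₚ.≃-Reasoning
  cross : + a ℤ.* + (1 ℕ.* suc d) ≡ (+ a ℤ.* + 1) ℤ.* + suc d
  cross = trans (cong (λ z → + a ℤ.* + z) (ℕₚ.*-identityˡ (suc d)))
                (cong (ℤ._* + suc d) (sym (ℤₚ.*-identityʳ (+ a))))

ℕtoℚ-∸ : ∀ {m n} → n ≤ m → ℕtoℚ (m ℕ.∸ n) ≡ ℕtoℚ m - ℕtoℚ n
ℕtoℚ-∸ {m} {n} n≤m = begin
  ℕtoℚ (m ℕ.∸ n)                         ≡⟨ add-sub (ℕtoℚ (m ℕ.∸ n)) (ℕtoℚ n) ⟩
  ℕtoℚ (m ℕ.∸ n) + ℕtoℚ n - ℕtoℚ n       ≡⟨ cong (_- ℕtoℚ n) (ℕtoℚ-+ (m ℕ.∸ n) n) ⟨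
  ℕtoℚ (m ℕ.∸ n ℕ.+ n) - ℕtoℚ n          ≡⟨ cong (λ k → ℕtoℚ k - ℕtoℚ n) (ℕₚ.m∸n+n≡m n≤m) ⟩
  ℕtoℚ m - ℕtoℚ n                        ∎
  where
  open ≡-Reasoning
  add-sub : ∀ x y → x ≡ x + y - y
  add-sub = solve-∀ ℚ-ring

[_]ℚ : Bool → ℚ
[ b ]ℚ = ℕtoℚ [ b ]ℕ

if-else-0 : ∀ b x → (if b then x else 0ℚ) ≡ [ b ]ℚ * x
if-else-0 true  x = sym (ℚₚ.*-identityˡ x)
if-else-0 false x = sym (ℚₚ.*-zeroˡ x)

if-1-else-0 : ∀ b → (if b then 1ℚ else 0ℚ) ≡ [ b ]ℚ
if-1-else-0 true  = refl
if-1-else-0 false = refl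

==-refl : ∀ {N} (i : Fin N) → (i == i) ≡ true
==-refl i = trans (isYes≗does (i Fin.≟ i)) (dec-true (i Fin.≟ i) refl)

==-sym : ∀ {N} (i j : Fin N) → (i == j) ≡ (j == i)
==-sym i j = trans (isYes≗does (i Fin.≟ j))
  (trans (does-⇔ (mk⇔ sym sym) (i Fin.≟ j) (j Fin.≟ i)) (sym (isYes≗does (j Fin.≟ i))))

suc-==-suc : ∀ {N} (i j : Fin N) → (Fin.suc i == suc j) ≡ (i == j)
suc-==-suc i j = trans (isYes≗does (suc i Fin.≟ suc j))
  (trans (does-⇔ (mk⇔ Finₚ.suc-injective (cong suc)) (suc i Fin.≟ suc j) (i Fin.≟ j)) (sym (isYes≗does (i Fin.≟ j))))

-- Finite sums

∑-cong : ∀ {N} {f g : Fin N → ℚ} → (∀ i → f i ≡ g i) → ∑ℚ f ≡ ∑ℚ g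
∑-cong {zero}  f≗g = refl
∑-cong {suc N} f≗g = cong₂ _+_ (f≗g zero) (∑-cong (λ i → f≗g (suc i)))

∑-distrib-+ : ∀ {N} (f g : Fin N → ℚ) → ∑ℚ (λ i → f i + g i) ≡ ∑ℚ f + ∑ℚ g
∑-distrib-+ {zero}  f g = refl
∑-distrib-+ {suc N} f g = trans (cong (λ z → f zero + g zero + z) (∑-distrib-+ (λ i → f (suc i)) (λ i → g (suc i))))
                                (interchange (f zero) (g zero) _ _)
  where
  interchange : ∀ a b c d → a + b + (c + d) ≡ a + c + (b + d)
  interchange = solve-∀ ℚ-ring

*-distribˡ-∑ : ∀ {N} c (f : Fin N → ℚ) → c * ∑ℚ f ≡ ∑ℚ (λ i → c * f i)
*-distribˡ-∑ {zero}  c f = ℚₚ.*-zeroʳ c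
*-distribˡ-∑ {suc N} c f = trans (ℚₚ.*-distribˡ-+ c (f zero) _)
                                 (cong (λ z → c * f zero + z) (*-distribˡ-∑ c (λ i → f (suc i))))

*-distribʳ-∑ : ∀ {N} c (f : Fin N → ℚ) → ∑ℚ f * c ≡ ∑ℚ (λ i → f i * c)
*-distribʳ-∑ c f = trans (ℚₚ.*-comm _ c) (trans (*-distribˡ-∑ c f) (∑-cong (λ i → ℚₚ.*-comm c (f i))))

∑-const : ∀ {N} c → ∑ℚ {N} (λ _ → c) ≡ ℕtoℚ N * c
∑-const {zero}  c = sym (ℚₚ.*-zeroˡ c)
∑-const {suc N} c = begin
  c + ∑ℚ {N} (λ _ → c)       ≡⟨ cong (λ z → c + z) (∑-const {N} c) ⟩
  c + ℕtoℚ N * c             ≡⟨ step c (ℕtoℚ N) ⟩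
  (1ℚ + ℕtoℚ N) * c          ≡⟨ cong (_* c) (ℕtoℚ-+ 1 N) ⟨
  ℕtoℚ (suc N) * c           ∎
  where
  open ≡-Reasoning
  step : ∀ c n → c + n * c ≡ (1ℚ + n) * c
  step = solve-∀ ℚ-ring

∑-zero : ∀ {N} → ∑ℚ {N} (λ _ → 0ℚ) ≡ 0ℚ
∑-zero {N} = trans (∑-const {N} 0ℚ) (ℚₚ.*-zeroʳ (ℕtoℚ N))

∑-comm : ∀ {M N} (f : Fin M → Fin N → ℚ) →
         ∑ℚ (λ i → ∑ℚ (λ j → f i j)) ≡ ∑ℚ (λ j → ∑ℚ (λ i → f i j))
∑-comm {zero}  {N} f = sym (∑-zero {N})
∑-comm {suc M} {N} f = trans (cong (λ z → ∑ℚ (f zero) + z) (∑-comm (λ i → f (suc i))))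
                             (sym (∑-distrib-+ (f zero) (λ j → ∑ℚ (λ i → f (suc i) j))))

∑-δ : ∀ {N} (i : Fin N) (f : Fin N → ℚ) → ∑ℚ (λ j → [ i == j ]ℚ * f j) ≡ f i
∑-δ {suc N} zero    f = begin
  1ℚ * f zero + ∑ℚ (λ j → 0ℚ * f (suc j))
    ≡⟨ cong (λ z → 1ℚ * f zero + z) (trans (∑-cong (λ j → ℚₚ.*-zeroˡ (f (suc j)))) (∑-zero {N})) ⟩
  1ℚ * f zero + 0ℚ
    ≡⟨ trans (ℚₚ.+-identityʳ _) (ℚₚ.*-identityˡ (f zero)) ⟩
  f zero
    ∎
  where open ≡-Reasoning
∑-δ {suc N} (suc i) f = begin
  0ℚ * f zero + ∑ℚ (λ j → [ suc i == suc j ]ℚ * f (suc j))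
    ≡⟨ cong₂ _+_ (ℚₚ.*-zeroˡ (f zero)) (∑-cong (λ j → cong (λ b → [ b ]ℚ * f (suc j)) (suc-==-suc i j))) ⟩
  0ℚ + ∑ℚ (λ j → [ i == j ]ℚ * f (suc j))
    ≡⟨ trans (ℚₚ.+-identityˡ _) (∑-δ i (λ j → f (suc j))) ⟩
  f (suc i)
    ∎
  where open ≡-Reasoning

∑-δʳ : ∀ {N} (i : Fin N) (f : Fin N → ℚ) → ∑ℚ (λ j → [ j == i ]ℚ * f j) ≡ f i
∑-δʳ i f = trans (∑-cong (λ j → cong (λ b → [ b ]ℚ * f j) (==-sym j i))) (∑-δ i f)

∑-δ-1 : ∀ {N} (i : Fin N) → ∑ℚ (λ j → [ i == j ]ℚ) ≡ 1ℚ
∑-δ-1 i = trans (∑-cong (λ j → sym (ℚₚ.*-identityʳ [ i == j ]ℚ))) (∑-δ i (λ _ → 1ℚ))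

∑-linear₃ : ∀ {N} a b c (f g h : Fin N → ℚ) →
            ∑ℚ (λ i → a * f i + b * g i + c * h i) ≡ a * ∑ℚ f + b * ∑ℚ g + c * ∑ℚ h
∑-linear₃ a b c f g h = begin
  ∑ℚ (λ i → a * f i + b * g i + c * h i)
    ≡⟨ ∑-distrib-+ (λ i → a * f i + b * g i) (λ i → c * h i) ⟩
  ∑ℚ (λ i → a * f i + b * g i) + ∑ℚ (λ i → c * h i)
    ≡⟨ cong (_+ ∑ℚ (λ i → c * h i)) (∑-distrib-+ (λ i → a * f i) (λ i → b * g i)) ⟩
  ∑ℚ (λ i → a * f i) + ∑ℚ (λ i → b * g i) + ∑ℚ (λ i → c * h i)
    ≡⟨ cong₂ _+_ (cong₂ _+_ (*-distribˡ-∑ a f) (*-distribˡ-∑ b g)) (*-distribˡ-∑ c h) ⟨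
  a * ∑ℚ f + b * ∑ℚ g + c * ∑ℚ h
    ∎
  where open ≡-Reasoning

∑-↑ : ∀ m k (f : Fin (m ℕ.+ k) → ℚ) → ∑ℚ f ≡ ∑ℚ (λ i → f (i ↑ˡ k)) + ∑ℚ (λ j → f (m ↑ʳ j))
∑-↑ zero    k f = sym (ℚₚ.+-identityˡ _)
∑-↑ (suc m) k f = trans (cong (λ z → f zero + z) (∑-↑ m k (λ i → f (suc i)))) (sym (ℚₚ.+-assoc (f zero) _ _))

∑-combine : ∀ m k (f : Fin (m ℕ.* k) → ℚ) → ∑ℚ f ≡ ∑ℚ {m} (λ i → ∑ℚ {k} (λ j → f (combine i j)))
∑-combine zero    k f = refl
∑-combine (suc m) k f = trans (∑-↑ k (m ℕ.* k) f)
  (cong (λ z → ∑ℚ (λ j → f (j ↑ˡ m ℕ.* k)) + z) (∑-combine m k (λ a → f (k ↑ʳ a))))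

∑-quotient : ∀ m k (φ : Fin m → ℚ) → ∑ℚ {m ℕ.* k} (λ w → φ (quotient {m} k w)) ≡ ℕtoℚ k * ∑ℚ φ
∑-quotient m k φ = begin
  ∑ℚ (λ w → φ (quotient {m} k w))
    ≡⟨ ∑-combine m k _ ⟩
  ∑ℚ (λ i → ∑ℚ (λ j → φ (quotient {m} k (combine {m} {k} i j))))
    ≡⟨ ∑-cong (λ i → ∑-cong (λ j → cong (φ ∘ proj₁) (Finₚ.remQuot-combine {k = k} i j))) ⟩
  ∑ℚ (λ i → ∑ℚ {k} (λ _ → φ i))
    ≡⟨ ∑-cong (λ i → ∑-const {k} (φ i)) ⟩
  ∑ℚ (λ i → ℕtoℚ k * φ i)
    ≡⟨ *-distribˡ-∑ (ℕtoℚ k) φ ⟨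
  ℕtoℚ k * ∑ℚ φ
    ∎
  where open ≡-Reasoning

ℕtoℚ-∑ : ∀ {N} (f : Fin N → ℕ) → ℕtoℚ (∑ℕ f) ≡ ∑ℚ (λ i → ℕtoℚ (f i))
ℕtoℚ-∑ {zero}  f = refl
ℕtoℚ-∑ {suc N} f = trans (ℕtoℚ-+ (f zero) _) (cong (λ z → ℕtoℚ (f zero) + z) (ℕtoℚ-∑ (λ i → f (suc i))))

-- Matrices and group inverses

≐-sym : ∀ {N} {A B : Matrix N} → A ≐ B → B ≐ A
≐-sym A≐B i j = sym (A≐B i j)

≐-trans : ∀ {N} {A B C : Matrix N} → A ≐ B → B ≐ C → A ≐ C
≐-trans A≐B B≐C i j = trans (A≐B i j) (B≐C i j)

≐-setoid : ℕ → Setoid _ _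
≐-setoid N = record
  { Carrier       = Matrix N
  ; _≈_           = _≐_
  ; isEquivalence = record { refl = λ i j → refl ; sym = ≐-sym ; trans = ≐-trans } }

module _ {N : ℕ} where

  ⊗-congˡ : ∀ {A A′} (B : Matrix N) → A ≐ A′ → (A ⊗ B) ≐ (A′ ⊗ B)
  ⊗-congˡ B A≐A′ i j = ∑-cong (λ k → cong (_* B k j) (A≐A′ i k))

  ⊗-congʳ : ∀ (A : Matrix N) {B B′} → B ≐ B′ → (A ⊗ B) ≐ (A ⊗ B′)
  ⊗-congʳ A B≐B′ i j = ∑-cong (λ k → cong (A i k *_) (B≐B′ k j))

  ⊗-cong : ∀ {A A′ B B′ : Matrix N} → A ≐ A′ → B ≐ B′ → (A ⊗ B) ≐ (A′ ⊗ B′)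
  ⊗-cong {A′ = A′} {B = B} A≐A′ B≐B′ = ≐-trans (⊗-congˡ B A≐A′) (⊗-congʳ A′ B≐B′)

  ⊗-assoc : ∀ (A B C : Matrix N) → ((A ⊗ B) ⊗ C) ≐ (A ⊗ (B ⊗ C))
  ⊗-assoc A B C i j = begin
    ∑ℚ (λ k → ∑ℚ (λ l → A i l * B l k) * C k j)
      ≡⟨ ∑-cong (λ k → *-distribʳ-∑ (C k j) (λ l → A i l * B l k)) ⟩
    ∑ℚ (λ k → ∑ℚ (λ l → A i l * B l k * C k j))
      ≡⟨ ∑-comm (λ k l → A i l * B l k * C k j) ⟩
    ∑ℚ (λ l → ∑ℚ (λ k → A i l * B l k * C k j))
      ≡⟨ ∑-cong (λ l → ∑-cong (λ k → ℚₚ.*-assoc (A i l) (B l k) (C k j))) ⟩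
    ∑ℚ (λ l → ∑ℚ (λ k → A i l * (B l k * C k j)))
      ≡⟨ ∑-cong (λ l → *-distribˡ-∑ (A i l) (λ k → B l k * C k j)) ⟨
    ∑ℚ (λ l → A i l * ∑ℚ (λ k → B l k * C k j))
      ∎
    where open ≡-Reasoning

  IsSymmetric : Matrix N → Set
  IsSymmetric A = ∀ i j → A i j ≡ A j i

  ⊗-transpose : ∀ {A B} → IsSymmetric A → IsSymmetric B → ∀ i j → (B ⊗ A) i j ≡ (A ⊗ B) j i
  ⊗-transpose {A} {B} A-sym B-sym i j =
    ∑-cong (λ k → trans (ℚₚ.*-comm (B i k) (A k j)) (cong₂ _*_ (A-sym k j) (B-sym i k)))

  IsGroupInverse-respˡ : ∀ {L L′ X : Matrix N} → L ≐ L′ → IsGroupInverse L X → IsGroupInverse L′ X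
  IsGroupInverse-respˡ {L} {L′} {X} L≐L′ (LXL≐L , XLX≐X , LX≐XL) =
      ≐-trans (≐-sym (⊗-cong (⊗-congˡ X L≐L′) L≐L′)) (≐-trans LXL≐L L≐L′)
    , ≐-trans (≐-sym (⊗-congˡ X (⊗-congʳ X L≐L′))) XLX≐X
    , ≐-trans (≐-sym (⊗-congˡ X L≐L′)) (≐-trans LX≐XL (⊗-congʳ X L≐L′))

  groupInverse-unique : ∀ {L X Y : Matrix N} → IsGroupInverse L X → IsGroupInverse L Y → X ≐ Y
  groupInverse-unique {L} {X} {Y} (LXL≐L , XLX≐X , LX≐XL) (LYL≐L , YLY≐Y , LY≐YL) = begin
    X                  ≈⟨ XLX≐X ⟨
    (X ⊗ L) ⊗ X        ≈⟨ ⊗-assoc X L X ⟩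
    X ⊗ (L ⊗ X)        ≈⟨ ⊗-congʳ X (≐-trans LX≐XL XL≐LY) ⟩
    X ⊗ (L ⊗ Y)        ≈⟨ ⊗-assoc X L Y ⟨
    (X ⊗ L) ⊗ Y        ≈⟨ ⊗-congˡ Y (≐-trans XL≐LY LY≐YL) ⟩
    (Y ⊗ L) ⊗ Y        ≈⟨ YLY≐Y ⟩
    Y                  ∎
    where
    open import Relation.Binary.Reasoning.Setoid (≐-setoid N)
    XL≐LY : (X ⊗ L) ≐ (L ⊗ Y)
    XL≐LY = begin
      X ⊗ L                    ≈⟨ ⊗-congʳ X LYL≐L ⟨
      X ⊗ ((L ⊗ Y) ⊗ L)        ≈⟨ ⊗-congʳ X (⊗-assoc L Y L) ⟩
      X ⊗ (L ⊗ (Y ⊗ L))        ≈⟨ ⊗-assoc X L (Y ⊗ L) ⟨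
      (X ⊗ L) ⊗ (Y ⊗ L)        ≈⟨ ⊗-cong LX≐XL LY≐YL ⟨
      (L ⊗ X) ⊗ (L ⊗ Y)        ≈⟨ ⊗-assoc (L ⊗ X) L Y ⟨
      ((L ⊗ X) ⊗ L) ⊗ Y        ≈⟨ ⊗-congˡ Y LXL≐L ⟩
      L ⊗ Y                    ∎

  I-sJ : ℚ → Matrix N
  I-sJ s i j = [ i == j ]ℚ - s

  ColumnsSumToZero : Matrix N → Set
  ColumnsSumToZero A = ∀ j → ∑ℚ (λ i → A i j) ≡ 0ℚ

  I-sJ-⊗ : ∀ s {A} → ColumnsSumToZero A → (I-sJ s ⊗ A) ≐ A
  I-sJ-⊗ s {A} A-columns i j = begin
    ∑ℚ (λ k → ([ i == k ]ℚ - s) * A k j)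
      ≡⟨ ∑-cong (λ k → expand [ i == k ]ℚ s (A k j)) ⟩
    ∑ℚ (λ k → [ i == k ]ℚ * A k j + (- s) * A k j)
      ≡⟨ ∑-distrib-+ (λ k → [ i == k ]ℚ * A k j) (λ k → (- s) * A k j) ⟩
    ∑ℚ (λ k → [ i == k ]ℚ * A k j) + ∑ℚ (λ k → (- s) * A k j)
      ≡⟨ cong₂ _+_ (∑-δ i (λ k → A k j)) (sym (*-distribˡ-∑ (- s) (λ k → A k j))) ⟩
    A i j + (- s) * ∑ℚ (λ k → A k j)
      ≡⟨ cong (λ z → A i j + (- s) * z) (A-columns j) ⟩
    A i j + (- s) * 0ℚ
      ≡⟨ drop-zero (A i j) s ⟩
    A i j
      ∎
    where
    open ≡-Reasoning
    expand : ∀ δ s a → (δ - s) * a ≡ δ * a + (- s) * a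
    expand = solve-∀ ℚ-ring
    drop-zero : ∀ a s → a + (- s) * 0ℚ ≡ a
    drop-zero = solve-∀ ℚ-ring

  isGroupInverse-I-sJ : ∀ {L X : Matrix N} s → IsSymmetric L → IsSymmetric X →
    (L ⊗ X) ≐ I-sJ s → ColumnsSumToZero L → ColumnsSumToZero X → IsGroupInverse L X
  isGroupInverse-I-sJ {L} {X} s L-sym X-sym LX≐I-sJ L-columns X-columns =
      ≐-trans (⊗-congˡ L LX≐I-sJ) (I-sJ-⊗ s L-columns)
    , ≐-trans (⊗-congˡ X XL≐I-sJ) (I-sJ-⊗ s X-columns)
    , ≐-trans LX≐I-sJ (≐-sym XL≐I-sJ)
    where
    XL≐I-sJ : (X ⊗ L) ≐ I-sJ s
    XL≐I-sJ i j = trans (⊗-transpose L-sym X-sym i j) (trans (LX≐I-sJ j i) (cong (λ b → [ b ]ℚ - s) (==-sym j i)))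

kemeny-cong : ∀ {N} (G : Graph N) {X Y : Matrix N} → X ≐ Y → kemeny G X ≡ kemeny G Y
kemeny-cong G {X} {Y} X≐Y = cong (recipℕ (4 ℕ.* numEdges G) *_) (∑-cong (λ i → ∑-cong (λ j →
  cong (ℕtoℚ (degree G i) * ℕtoℚ (degree G j) *_) (resistance-cong i j))))
  where
  resistance-cong : ∀ i j → resistance X i j ≡ resistance Y i j
  resistance-cong i j = cong₂ _-_ (cong₂ _+_ (X≐Y i i) (X≐Y j j)) (cong (ℕtoℚ 2 *_) (X≐Y i j))

handshake : ∀ {N} (G : Graph N) → (∀ i j → G i j ≡ G j i) → (∀ i → G i i ≡ false) →
            ℕtoℚ (numEdges G) + ℕtoℚ (numEdges G) ≡ ∑ℚ (λ i → ℕtoℚ (degree G i))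
handshake {N} G G-sym G-irrefl = begin
  E + E
    ≡⟨ cong₂ _+_ E≡ (trans E≡ (∑-comm before)) ⟩
  ∑ℚ (λ i → ∑ℚ (before i)) + ∑ℚ (λ i → ∑ℚ (λ j → before j i))
    ≡⟨ ∑-distrib-+ (λ i → ∑ℚ (before i)) (λ i → ∑ℚ (λ j → before j i)) ⟨
  ∑ℚ (λ i → ∑ℚ (before i) + ∑ℚ (λ j → before j i))
    ≡⟨ ∑-cong (λ i → ∑-distrib-+ (before i) (λ j → before j i)) ⟨
  ∑ℚ (λ i → ∑ℚ (λ j → before i j + before j i))
    ≡⟨ ∑-cong (λ i → ∑-cong (λ j → split i j)) ⟨
  ∑ℚ (λ i → ∑ℚ (λ j → [ G i j ]ℚ))
    ≡⟨ ∑-cong (λ i → ℕtoℚ-∑ (λ j → [ G i j ]ℕ)) ⟨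
  ∑ℚ (λ i → ℕtoℚ (degree G i))
    ∎
  where
  open ≡-Reasoning
  E : ℚ
  E = ℕtoℚ (numEdges G)
  before : Fin N → Fin N → ℚ
  before i j = [ ⌊ i <? j ⌋ ∧ G i j ]ℚ
  E≡ : E ≡ ∑ℚ (λ i → ∑ℚ (before i))
  E≡ = trans (ℕtoℚ-∑ (λ i → ∑ℕ (λ j → [ ⌊ i <? j ⌋ ∧ G i j ]ℕ)))
             (∑-cong (λ i → ℕtoℚ-∑ (λ j → [ ⌊ i <? j ⌋ ∧ G i j ]ℕ)))
  split : ∀ i j → [ G i j ]ℚ ≡ before i j + before j i
  split i j with i <? j | j <? i
  ... | yes i<j | yes j<i = ⊥-elim (Finₚ.<-asym i<j j<i)
  ... | yes _   | no _    = sym (ℚₚ.+-identityʳ _)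
  ... | no _    | yes _   = trans (cong [_]ℚ (G-sym i j)) (sym (ℚₚ.+-identityˡ _))
  ... | no i≮j  | no j≮i  with Finₚ.<-cmp i j
  ...   | tri< i<j _ _ = ⊥-elim (i≮j i<j)
  ...   | tri> _ _ j<i = ⊥-elim (j≮i j<i)
  ...   | tri≈ _ refl _ = cong [_]ℚ (G-irrefl i)

module Windmill (t n : ℕ) where

  M : ℕ
  M = t ℕ.* n

  mℚ nℚ : ℚ
  mℚ = ℕtoℚ M
  nℚ = ℕtoℚ n

  sameBlade : Fin M → Fin M → Bool
  sameBlade u w = quotient {t} n u == quotient {t} n w

  sameBlade-refl : ∀ u → sameBlade u u ≡ true
  sameBlade-refl u = ==-refl (quotient {t} n u)

  sameBlade-sym : ∀ u w → sameBlade u w ≡ sameBlade w u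
  sameBlade-sym u w = ==-sym (quotient {t} n u) (quotient {t} n w)

  ∑-sameBlade : ∀ u → ∑ℚ (λ w → [ sameBlade u w ]ℚ) ≡ nℚ
  ∑-sameBlade u = begin
    ∑ℚ (λ w → [ sameBlade u w ]ℚ)                  ≡⟨ ∑-quotient t n (λ b → [ quotient {t} n u == b ]ℚ) ⟩
    nℚ * ∑ℚ (λ b → [ quotient {t} n u == b ]ℚ)     ≡⟨ cong (nℚ *_) (∑-δ-1 (quotient {t} n u)) ⟩
    nℚ * 1ℚ                                        ≡⟨ ℚₚ.*-identityʳ nℚ ⟩
    nℚ                                             ∎
    where open ≡-Reasoning

  ∑-sameBlade-sameBlade : ∀ u v →
    ∑ℚ (λ w → [ sameBlade u w ]ℚ * [ sameBlade w v ]ℚ) ≡ nℚ * [ sameBlade u v ]ℚ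
  ∑-sameBlade-sameBlade u v =
    trans (∑-quotient t n (λ b → [ quotient {t} n u == b ]ℚ * [ b == quotient {t} n v ]ℚ))
          (cong (nℚ *_) (∑-δ (quotient {t} n u) (λ b → [ b == quotient {t} n v ]ℚ)))

  bladeMatrix : ℚ → ℚ → ℚ → Fin M → Fin M → ℚ
  bladeMatrix c d e u w = c + d * [ sameBlade u w ]ℚ + e * [ u == w ]ℚ

  bladeLineSum : ℚ → ℚ → ℚ → ℚ
  bladeLineSum c d e = c * mℚ + d * nℚ + e

  bladeMatrix-sym : ∀ c d e u w → bladeMatrix c d e u w ≡ bladeMatrix c d e w u
  bladeMatrix-sym c d e u w = cong₂ (λ x y → c + d * [ x ]ℚ + e * [ y ]ℚ) (sameBlade-sym u w) (==-sym u w)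

  bladeMatrix-diag : ∀ c d e u → bladeMatrix c d e u u ≡ c + d + e
  bladeMatrix-diag c d e u =
    trans (cong₂ (λ x y → c + d * [ x ]ℚ + e * [ y ]ℚ) (sameBlade-refl u) (==-refl u)) (times-one c d e)
    where
    times-one : ∀ c d e → c + d * 1ℚ + e * 1ℚ ≡ c + d + e
    times-one = solve-∀ ℚ-ring

  bladeMatrix-+ : ∀ x c d e u v → x + bladeMatrix c d e u v ≡ bladeMatrix (x + c) d e u v
  bladeMatrix-+ x c d e u v = shift x c d e [ sameBlade u v ]ℚ [ u == v ]ℚ
    where
    shift : ∀ x c d e y z → x + (c + d * y + e * z) ≡ x + c + d * y + e * z
    shift = solve-∀ ℚ-ring

  ∑-bladeMatrix-* : ∀ c d e u (g : Fin M → ℚ) →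
    ∑ℚ (λ w → bladeMatrix c d e u w * g w) ≡ c * ∑ℚ g + d * ∑ℚ (λ w → [ sameBlade u w ]ℚ * g w) + e * g u
  ∑-bladeMatrix-* c d e u g = begin
    ∑ℚ (λ w → bladeMatrix c d e u w * g w)
      ≡⟨ ∑-cong (λ w → expand c d e [ sameBlade u w ]ℚ [ u == w ]ℚ (g w)) ⟩
    ∑ℚ (λ w → c * g w + d * ([ sameBlade u w ]ℚ * g w) + e * ([ u == w ]ℚ * g w))
      ≡⟨ ∑-linear₃ c d e g (λ w → [ sameBlade u w ]ℚ * g w) (λ w → [ u == w ]ℚ * g w) ⟩
    c * ∑ℚ g + d * ∑ℚ (λ w → [ sameBlade u w ]ℚ * g w) + e * ∑ℚ (λ w → [ u == w ]ℚ * g w)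
      ≡⟨ cong (λ z → c * ∑ℚ g + d * ∑ℚ (λ w → [ sameBlade u w ]ℚ * g w) + e * z) (∑-δ u g) ⟩
    c * ∑ℚ g + d * ∑ℚ (λ w → [ sameBlade u w ]ℚ * g w) + e * g u
      ∎
    where
    open ≡-Reasoning
    expand : ∀ c d e x y z → (c + d * x + e * y) * z ≡ c * z + d * (x * z) + e * (y * z)
    expand = solve-∀ ℚ-ring

  ∑-bladeMatrix : ∀ c d e u → ∑ℚ (λ w → bladeMatrix c d e u w) ≡ bladeLineSum c d e
  ∑-bladeMatrix c d e u = begin
    ∑ℚ (λ w → bladeMatrix c d e u w)
      ≡⟨ ∑-cong (λ w → sym (ℚₚ.*-identityʳ (bladeMatrix c d e u w))) ⟩
    ∑ℚ (λ w → bladeMatrix c d e u w * 1ℚ)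
      ≡⟨ ∑-bladeMatrix-* c d e u (λ _ → 1ℚ) ⟩
    c * ∑ℚ {M} (λ _ → 1ℚ) + d * ∑ℚ (λ w → [ sameBlade u w ]ℚ * 1ℚ) + e * 1ℚ
      ≡⟨ cong₂ (λ x y → c * x + d * y + e * 1ℚ) (∑-const {M} 1ℚ)
               (trans (∑-cong (λ w → ℚₚ.*-identityʳ [ sameBlade u w ]ℚ)) (∑-sameBlade u)) ⟩
    c * (mℚ * 1ℚ) + d * nℚ + e * 1ℚ
      ≡⟨ times-one c d e mℚ nℚ ⟩
    bladeLineSum c d e
      ∎
    where
    open ≡-Reasoning
    times-one : ∀ c d e m n → c * (m * 1ℚ) + d * n + e * 1ℚ ≡ c * m + d * n + e
    times-one = solve-∀ ℚ-ring

  ∑-bladeMatrix-column : ∀ c d e v → ∑ℚ (λ w → bladeMatrix c d e w v) ≡ bladeLineSum c d e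
  ∑-bladeMatrix-column c d e v = trans (∑-cong (λ w → bladeMatrix-sym c d e w v)) (∑-bladeMatrix c d e v)

  ∑-sameBlade-bladeMatrix : ∀ c d e u v →
    ∑ℚ (λ w → [ sameBlade u w ]ℚ * bladeMatrix c d e w v) ≡ c * nℚ + (d * nℚ + e) * [ sameBlade u v ]ℚ
  ∑-sameBlade-bladeMatrix c d e u v = begin
    ∑ℚ (λ w → [ sameBlade u w ]ℚ * bladeMatrix c d e w v)
      ≡⟨ ∑-cong (λ w → expand c d e [ sameBlade u w ]ℚ [ sameBlade w v ]ℚ [ w == v ]ℚ) ⟩
    ∑ℚ (λ w → c * [ sameBlade u w ]ℚ + d * ([ sameBlade u w ]ℚ * [ sameBlade w v ]ℚ)
              + e * ([ w == v ]ℚ * [ sameBlade u w ]ℚ))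
      ≡⟨ ∑-linear₃ c d e (λ w → [ sameBlade u w ]ℚ) (λ w → [ sameBlade u w ]ℚ * [ sameBlade w v ]ℚ)
                          (λ w → [ w == v ]ℚ * [ sameBlade u w ]ℚ) ⟩
    c * ∑ℚ (λ w → [ sameBlade u w ]ℚ) + d * ∑ℚ (λ w → [ sameBlade u w ]ℚ * [ sameBlade w v ]ℚ)
      + e * ∑ℚ (λ w → [ w == v ]ℚ * [ sameBlade u w ]ℚ)
      ≡⟨ cong₂ _+_ (cong₂ (λ x y → c * x + d * y) (∑-sameBlade u) (∑-sameBlade-sameBlade u v))
                   (cong (e *_) (∑-δʳ v (λ w → [ sameBlade u w ]ℚ))) ⟩
    c * nℚ + d * (nℚ * [ sameBlade u v ]ℚ) + e * [ sameBlade u v ]ℚ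
      ≡⟨ collect c d e nℚ [ sameBlade u v ]ℚ ⟩
    c * nℚ + (d * nℚ + e) * [ sameBlade u v ]ℚ
      ∎
    where
    open ≡-Reasoning
    expand : ∀ c d e x y z → x * (c + d * y + e * z) ≡ c * x + d * (x * y) + e * (z * x)
    expand = solve-∀ ℚ-ring
    collect : ∀ c d e n x → c * n + d * (n * x) + e * x ≡ c * n + (d * n + e) * x
    collect = solve-∀ ℚ-ring

  ∑-bladeMatrix-bladeMatrix : ∀ c d e c′ d′ e′ u v →
    ∑ℚ (λ w → bladeMatrix c d e u w * bladeMatrix c′ d′ e′ w v)
      ≡ bladeMatrix (c * bladeLineSum c′ d′ e′ + d * (c′ * nℚ) + e * c′) (d * (d′ * nℚ + e′) + e * d′) (e * e′) u v
  ∑-bladeMatrix-bladeMatrix c d e c′ d′ e′ u v = begin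
    ∑ℚ (λ w → bladeMatrix c d e u w * bladeMatrix c′ d′ e′ w v)
      ≡⟨ ∑-bladeMatrix-* c d e u (λ w → bladeMatrix c′ d′ e′ w v) ⟩
    c * ∑ℚ (λ w → bladeMatrix c′ d′ e′ w v) + d * ∑ℚ (λ w → [ sameBlade u w ]ℚ * bladeMatrix c′ d′ e′ w v)
      + e * bladeMatrix c′ d′ e′ u v
      ≡⟨ cong₂ (λ x y → c * x + d * y + e * bladeMatrix c′ d′ e′ u v)
               (∑-bladeMatrix-column c′ d′ e′ v)
               (∑-sameBlade-bladeMatrix c′ d′ e′ u v) ⟩
    c * bladeLineSum c′ d′ e′ + d * (c′ * nℚ + (d′ * nℚ + e′) * [ sameBlade u v ]ℚ) + e * bladeMatrix c′ d′ e′ u v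
      ≡⟨ collect c d e (bladeLineSum c′ d′ e′) c′ d′ e′ nℚ [ sameBlade u v ]ℚ [ u == v ]ℚ ⟩
    bladeMatrix (c * bladeLineSum c′ d′ e′ + d * (c′ * nℚ) + e * c′) (d * (d′ * nℚ + e′) + e * d′) (e * e′) u v
      ∎
    where
    open ≡-Reasoning
    collect : ∀ c d e σ c′ d′ e′ n x y →
      c * σ + d * (c′ * n + (d′ * n + e′) * x) + e * (c′ + d′ * x + e′ * y)
        ≡ (c * σ + d * (c′ * n) + e * c′) + (d * (d′ * n + e′) + e * d′) * x + (e * e′) * y
    collect = solve-∀ ℚ-ring

  record Form : Set where
    constructor form
    field
      corner row column onAll onSameBlade onDiagonal : ℚ

  ⟦_⟧ : Form → Matrix (suc M)
  ⟦ form a r k c d e ⟧ zero    zero    = a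
  ⟦ form a r k c d e ⟧ zero    (suc v) = r
  ⟦ form a r k c d e ⟧ (suc u) zero    = k
  ⟦ form a r k c d e ⟧ (suc u) (suc v) = bladeMatrix c d e u v

  _·_ : Form → Form → Form
  form a r k c d e · form a′ r′ k′ c′ d′ e′ = form
    (a * a′ + mℚ * (r * k′))
    (a * r′ + r * bladeLineSum c′ d′ e′)
    (k * a′ + bladeLineSum c d e * k′)
    (k * r′ + (c * bladeLineSum c′ d′ e′ + d * (c′ * nℚ) + e * c′))
    (d * (d′ * nℚ + e′) + e * d′)
    (e * e′)

  ⊗-⟦⟧ : ∀ f g → (⟦ f ⟧ ⊗ ⟦ g ⟧) ≐ ⟦ f · g ⟧
  ⊗-⟦⟧ (form a r k c d e) (form a′ r′ k′ c′ d′ e′) zero zero =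
    cong (_+_ (a * a′)) (∑-const {M} (r * k′))
  ⊗-⟦⟧ (form a r k c d e) (form a′ r′ k′ c′ d′ e′) zero (suc v) =
    cong (_+_ (a * r′)) (trans (sym (*-distribˡ-∑ r (λ w → bladeMatrix c′ d′ e′ w v)))
                            (cong (r *_) (∑-bladeMatrix-column c′ d′ e′ v)))
  ⊗-⟦⟧ (form a r k c d e) (form a′ r′ k′ c′ d′ e′) (suc u) zero =
    cong (_+_ (k * a′)) (trans (sym (*-distribʳ-∑ k′ (bladeMatrix c d e u)))
                            (cong (_* k′) (∑-bladeMatrix c d e u)))
  ⊗-⟦⟧ (form a r k c d e) (form a′ r′ k′ c′ d′ e′) (suc u) (suc v) =
    trans (cong (_+_ (k * r′)) (∑-bladeMatrix-bladeMatrix c d e c′ d′ e′ u v))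
          (bladeMatrix-+ (k * r′) (c * bladeLineSum c′ d′ e′ + d * (c′ * nℚ) + e * c′)
                         (d * (d′ * nℚ + e′) + e * d′) (e * e′) u v)

  form-cong : ∀ {a r k c d e a′ r′ k′ c′ d′ e′} →
              a ≡ a′ → r ≡ r′ → k ≡ k′ → c ≡ c′ → d ≡ d′ → e ≡ e′ → form a r k c d e ≡ form a′ r′ k′ c′ d′ e′
  form-cong refl refl refl refl refl refl = refl

  ⟦⟧-symmetric : ∀ a r c d e → IsSymmetric ⟦ form a r r c d e ⟧
  ⟦⟧-symmetric a r c d e zero    zero    = refl
  ⟦⟧-symmetric a r c d e zero    (suc v) = refl
  ⟦⟧-symmetric a r c d e (suc u) zero    = refl
  ⟦⟧-symmetric a r c d e (suc u) (suc v) = bladeMatrix-sym c d e u v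

  ⟦⟧-columnsSumToZero : ∀ a r k c d e → a + mℚ * k ≡ 0ℚ → r + bladeLineSum c d e ≡ 0ℚ →
                        ColumnsSumToZero ⟦ form a r k c d e ⟧
  ⟦⟧-columnsSumToZero a r k c d e first-column _ zero =
    trans (cong (_+_ a) (∑-const {M} k)) first-column
  ⟦⟧-columnsSumToZero a r k c d e _ other-columns (suc v) =
    trans (cong (_+_ r) (∑-bladeMatrix-column c d e v)) other-columns

  ∑-⟦⟧-row : ∀ a r k c d e → ∑ℚ (⟦ form a r k c d e ⟧ zero) ≡ a + mℚ * r
  ∑-⟦⟧-row a r k c d e = cong (_+_ a) (∑-const {M} r)

  ∑-⟦⟧-blade-row : ∀ a r k c d e u → ∑ℚ (⟦ form a r k c d e ⟧ (suc u)) ≡ k + bladeLineSum c d e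
  ∑-⟦⟧-blade-row a r k c d e u = cong (_+_ k) (∑-bladeMatrix c d e u)

  entrySum : Form → ℚ
  entrySum (form a r k c d e) = a + mℚ * r + mℚ * (k + bladeLineSum c d e)

  ∑∑-⟦⟧ : ∀ f → ∑ℚ (λ i → ∑ℚ (⟦ f ⟧ i)) ≡ entrySum f
  ∑∑-⟦⟧ (form a r k c d e) = cong₂ _+_ (∑-⟦⟧-row a r k c d e)
    (trans (∑-cong (∑-⟦⟧-blade-row a r k c d e)) (∑-const {M} (k + bladeLineSum c d e)))

  resistanceForm : Form → Form
  resistanceForm (form a r k c d e) = form
    0ℚ (a + (c + d + e) - ℕtoℚ 2 * r) ((c + d + e) + a - ℕtoℚ 2 * k)
    ((c + d + e) + (c + d + e) - ℕtoℚ 2 * c) (- (ℕtoℚ 2 * d)) (- (ℕtoℚ 2 * e))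

  resistance-⟦⟧ : ∀ f → resistance ⟦ f ⟧ ≐ ⟦ resistanceForm f ⟧
  resistance-⟦⟧ (form a r k c d e) zero zero = cancel a
    where
    cancel : ∀ a → a + a - ℕtoℚ 2 * a ≡ 0ℚ
    cancel = solve-∀ ℚ-ring
  resistance-⟦⟧ (form a r k c d e) zero (suc v) =
    cong (λ x → a + x - ℕtoℚ 2 * r) (bladeMatrix-diag c d e v)
  resistance-⟦⟧ (form a r k c d e) (suc u) zero =
    cong (λ x → x + a - ℕtoℚ 2 * k) (bladeMatrix-diag c d e u)
  resistance-⟦⟧ (form a r k c d e) (suc u) (suc v) =
    trans (cong₂ (λ x y → x + y - ℕtoℚ 2 * bladeMatrix c d e u v) (bladeMatrix-diag c d e u) (bladeMatrix-diag c d e v))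
          (collect (c + d + e) c d e [ sameBlade u v ]ℚ [ u == v ]ℚ)
    where
    collect : ∀ D c d e y z → D + D - ℕtoℚ 2 * (c + d * y + e * z)
                              ≡ D + D - ℕtoℚ 2 * c + (- (ℕtoℚ 2 * d)) * y + (- (ℕtoℚ 2 * e)) * z
    collect = solve-∀ ℚ-ring

  vertexWeight : ℚ → ℚ → Fin (suc M) → ℚ
  vertexWeight α β zero    = α
  vertexWeight α β (suc _) = β

  weigh : ℚ → ℚ → Form → Form
  weigh α β (form a r k c d e) = form (α * α * a) (α * β * r) (β * α * k) (β * β * c) (β * β * d) (β * β * e)

  weigh-⟦⟧ : ∀ α β f i j → vertexWeight α β i * vertexWeight α β j * ⟦ f ⟧ i j ≡ ⟦ weigh α β f ⟧ i j
  weigh-⟦⟧ α β (form a r k c d e) zero    zero    = refl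
  weigh-⟦⟧ α β (form a r k c d e) zero    (suc v) = refl
  weigh-⟦⟧ α β (form a r k c d e) (suc u) zero    = refl
  weigh-⟦⟧ α β (form a r k c d e) (suc u) (suc v) = distrib (β * β) c d e [ sameBlade u v ]ℚ [ u == v ]ℚ
    where
    distrib : ∀ w c d e y z → w * (c + d * y + e * z) ≡ w * c + w * d * y + w * e * z
    distrib = solve-∀ ℚ-ring

  G : Graph (suc M)
  G = windmill t n

  [sameBlade∧not==] : ∀ u w → [ sameBlade u w ∧ not (u == w) ]ℚ ≡ [ sameBlade u w ]ℚ - [ u == w ]ℚ
  [sameBlade∧not==] u w with u Fin.≟ w
  ... | yes refl rewrite sameBlade-refl u = refl
  ... | no _ with sameBlade u w
  ...   | true  = refl
  ...   | false = refl

  adjacencyForm : Form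
  adjacencyForm = form 0ℚ 1ℚ 1ℚ 0ℚ 1ℚ (- 1ℚ)

  adjacency-⟦⟧ : ∀ i j → [ G i j ]ℚ ≡ ⟦ adjacencyForm ⟧ i j
  adjacency-⟦⟧ zero    zero    = refl
  adjacency-⟦⟧ zero    (suc v) = refl
  adjacency-⟦⟧ (suc u) zero    = refl
  adjacency-⟦⟧ (suc u) (suc v) = trans ([sameBlade∧not==] u v) (as-bladeMatrix [ sameBlade u v ]ℚ [ u == v ]ℚ)
    where
    as-bladeMatrix : ∀ y z → y - z ≡ 0ℚ + 1ℚ * y + (- 1ℚ) * z
    as-bladeMatrix = solve-∀ ℚ-ring

  degree-windmill : ∀ i → ℕtoℚ (degree G i) ≡ vertexWeight mℚ nℚ i
  degree-windmill i = begin
    ℕtoℚ (degree G i)            ≡⟨ ℕtoℚ-∑ (λ j → [ G i j ]ℕ) ⟩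
    ∑ℚ (λ j → [ G i j ]ℚ)        ≡⟨ ∑-cong (adjacency-⟦⟧ i) ⟩
    ∑ℚ (⟦ adjacencyForm ⟧ i)     ≡⟨ row-sum i ⟩
    vertexWeight mℚ nℚ i         ∎
    where
    open ≡-Reasoning
    row-sum : ∀ i → ∑ℚ (⟦ adjacencyForm ⟧ i) ≡ vertexWeight mℚ nℚ i
    row-sum zero    = trans (∑-⟦⟧-row 0ℚ 1ℚ 1ℚ 0ℚ 1ℚ (- 1ℚ)) (centre mℚ)
      where
      centre : ∀ m → 0ℚ + m * 1ℚ ≡ m
      centre = solve-∀ ℚ-ring
    row-sum (suc u) = trans (∑-⟦⟧-blade-row 0ℚ 1ℚ 1ℚ 0ℚ 1ℚ (- 1ℚ) u) (blade mℚ nℚ)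
      where
      blade : ∀ m n → 1ℚ + (0ℚ * m + 1ℚ * n + (- 1ℚ)) ≡ n
      blade = solve-∀ ℚ-ring

  laplacianForm : Form
  laplacianForm = form mℚ (- 1ℚ) (- 1ℚ) 0ℚ (- 1ℚ) (nℚ + 1ℚ)

  laplacian-⟦⟧ : laplacian G ≐ ⟦ laplacianForm ⟧
  laplacian-⟦⟧ i j = begin
    laplacian G i j
      ≡⟨ cong₂ _-_ (if-else-0 (i == j) (ℕtoℚ (degree G i))) (if-1-else-0 (G i j)) ⟩
    [ i == j ]ℚ * ℕtoℚ (degree G i) - [ G i j ]ℚ
      ≡⟨ cong₂ (λ x y → [ i == j ]ℚ * x - y) (degree-windmill i) (adjacency-⟦⟧ i j) ⟩
    [ i == j ]ℚ * vertexWeight mℚ nℚ i - ⟦ adjacencyForm ⟧ i j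
      ≡⟨ entry i j ⟩
    ⟦ laplacianForm ⟧ i j
      ∎
    where
    open ≡-Reasoning
    centre : ∀ m → 1ℚ * m - 0ℚ ≡ m
    centre = solve-∀ ℚ-ring
    spoke : ∀ x → 0ℚ * x - 1ℚ ≡ - 1ℚ
    spoke = solve-∀ ℚ-ring
    blade : ∀ n y z → z * n - (0ℚ + 1ℚ * y + (- 1ℚ) * z) ≡ 0ℚ + (- 1ℚ) * y + (n + 1ℚ) * z
    blade = solve-∀ ℚ-ring
    entry : ∀ i j → [ i == j ]ℚ * vertexWeight mℚ nℚ i - ⟦ adjacencyForm ⟧ i j ≡ ⟦ laplacianForm ⟧ i j
    entry zero    zero    = centre mℚ
    entry zero    (suc v) = spoke mℚ
    entry (suc u) zero    = spoke nℚ
    entry (suc u) (suc v) =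
      trans (cong (λ b → [ b ]ℚ * nℚ - bladeMatrix 0ℚ 1ℚ (- 1ℚ) u v) (suc-==-suc u v))
            (blade nℚ [ sameBlade u v ]ℚ [ u == v ]ℚ)

  windmill-sym : ∀ i j → G i j ≡ G j i
  windmill-sym zero    zero    = refl
  windmill-sym zero    (suc v) = refl
  windmill-sym (suc u) zero    = refl
  windmill-sym (suc u) (suc v) = cong₂ (λ x y → x ∧ not y) (sameBlade-sym u v) (==-sym u v)

  windmill-irrefl : ∀ i → G i i ≡ false
  windmill-irrefl zero    = refl
  windmill-irrefl (suc u) = cong₂ (λ x y → x ∧ not y) (sameBlade-refl u) (==-refl u)

  numEdges-windmill : numEdges G ℕ.+ numEdges G ≡ M ℕ.* suc n
  numEdges-windmill = ℕtoℚ-injective (begin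
    ℕtoℚ (numEdges G ℕ.+ numEdges G)                ≡⟨ ℕtoℚ-+ (numEdges G) (numEdges G) ⟩
    ℕtoℚ (numEdges G) + ℕtoℚ (numEdges G)           ≡⟨ handshake G windmill-sym windmill-irrefl ⟩
    ∑ℚ (λ i → ℕtoℚ (degree G i))                    ≡⟨ ∑-cong degree-windmill ⟩
    mℚ + ∑ℚ {M} (λ _ → nℚ)                          ≡⟨ cong (_+_ mℚ) (∑-const {M} nℚ) ⟩
    mℚ + mℚ * nℚ                                    ≡⟨ factor mℚ nℚ ⟩
    mℚ * (1ℚ + nℚ)                                  ≡⟨ cong (_*_ mℚ) (ℕtoℚ-+ 1 n) ⟨
    ℕtoℚ M * ℕtoℚ (suc n)                           ≡⟨ ℕtoℚ-* M (suc n) ⟨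
    ℕtoℚ (M ℕ.* suc n)                              ∎)
    where
    open ≡-Reasoning
    factor : ∀ m n → m + m * n ≡ m * (1ℚ + n)
    factor = solve-∀ ℚ-ring

  s p : ℚ
  s = recipℕ (suc M)
  p = recipℕ (suc n)

  s-inverse : s * (1ℚ + mℚ) ≡ 1ℚ
  s-inverse = trans (cong (_*_ s) (sym (ℕtoℚ-+ 1 M))) (recipℕ-inverse (suc M))

  p-inverse : p * (1ℚ + nℚ) ≡ 1ℚ
  p-inverse = trans (cong (_*_ p) (sym (ℕtoℚ-+ 1 n))) (recipℕ-inverse (suc n))

  -- (L + s J)⁻¹ − s J, where s = 1/(tn+1) is one over the number of vertices.
  groupInverseForm : Form
  groupInverseForm = form (mℚ * s * s) (- (s * s)) (- (s * s)) (- (s * s) - s) p p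

  I-sJ-Form : Form
  I-sJ-Form = form (1ℚ - s) (- s) (- s) (- s) 0ℚ 1ℚ

  ⟦I-sJ-Form⟧ : ⟦ I-sJ-Form ⟧ ≐ I-sJ s
  ⟦I-sJ-Form⟧ zero    zero    = refl
  ⟦I-sJ-Form⟧ zero    (suc v) = sym (ℚₚ.+-identityˡ (- s))
  ⟦I-sJ-Form⟧ (suc u) zero    = sym (ℚₚ.+-identityˡ (- s))
  ⟦I-sJ-Form⟧ (suc u) (suc v) =
    trans (blade s [ sameBlade u v ]ℚ [ u == v ]ℚ) (cong (λ b → [ b ]ℚ - s) (sym (suc-==-suc u v)))
    where
    blade : ∀ s y z → - s + 0ℚ * y + 1ℚ * z ≡ z - s
    blade = solve-∀ ℚ-ring

  laplacian·groupInverse : laplacianForm · groupInverseForm ≡ I-sJ-Form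
  laplacian·groupInverse = form-cong
    (≡-modulo (mℚ * s + 1ℚ) s-inverse (corner mℚ s))
    (≡-modulo₂ 1ℚ (- 1ℚ) s-inverse p-inverse (row mℚ nℚ s p))
    (≡-modulo (- s) s-inverse (column mℚ nℚ s))
    (blade-all mℚ nℚ s p)
    (blade-same nℚ p)
    (≡-modulo 1ℚ p-inverse (blade-diagonal nℚ p))
    where
    corner : ∀ m s → m * (m * s * s) + m * ((- 1ℚ) * (- (s * s))) ≡ (1ℚ - s) + (m * s + 1ℚ) * (s * (1ℚ + m) - 1ℚ)
    corner = solve-∀ ℚ-ring
    row : ∀ m n s p → m * (- (s * s)) + (- 1ℚ) * ((- (s * s) - s) * m + p * n + p)
                      ≡ - s + 1ℚ * (s * (1ℚ + m) - 1ℚ) + (- 1ℚ) * (p * (1ℚ + n) - 1ℚ)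
    row = solve-∀ ℚ-ring
    column : ∀ m n s → (- 1ℚ) * (m * s * s) + (0ℚ * m + (- 1ℚ) * n + (n + 1ℚ)) * (- (s * s))
                       ≡ - s + (- s) * (s * (1ℚ + m) - 1ℚ)
    column = solve-∀ ℚ-ring
    blade-all : ∀ m n s p → (- 1ℚ) * (- (s * s))
                            + (0ℚ * ((- (s * s) - s) * m + p * n + p) + (- 1ℚ) * ((- (s * s) - s) * n) + (n + 1ℚ) * (- (s * s) - s))
                            ≡ - s
    blade-all = solve-∀ ℚ-ring
    blade-same : ∀ n p → (- 1ℚ) * (p * n + p) + (n + 1ℚ) * p ≡ 0ℚ
    blade-same = solve-∀ ℚ-ring
    blade-diagonal : ∀ n p → (n + 1ℚ) * p ≡ 1ℚ + 1ℚ * (p * (1ℚ + n) - 1ℚ)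
    blade-diagonal = solve-∀ ℚ-ring

  groupInverse : IsGroupInverse (laplacian G) ⟦ groupInverseForm ⟧
  groupInverse = IsGroupInverse-respˡ (≐-sym laplacian-⟦⟧)
    (isGroupInverse-I-sJ s (⟦⟧-symmetric mℚ (- 1ℚ) 0ℚ (- 1ℚ) (nℚ + 1ℚ))
                           (⟦⟧-symmetric (mℚ * s * s) (- (s * s)) (- (s * s) - s) p p)
                           LX≐I-sJ
                           (⟦⟧-columnsSumToZero mℚ (- 1ℚ) (- 1ℚ) 0ℚ (- 1ℚ) (nℚ + 1ℚ) (L-centre mℚ) (L-blade mℚ nℚ))
                           (⟦⟧-columnsSumToZero (mℚ * s * s) (- (s * s)) (- (s * s)) (- (s * s) - s) p p
                              (X-centre mℚ s) (≡-modulo₂ (- s - 1ℚ) 1ℚ s-inverse p-inverse (X-blade mℚ nℚ s p))))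
    where
    LX≐I-sJ : (⟦ laplacianForm ⟧ ⊗ ⟦ groupInverseForm ⟧) ≐ I-sJ s
    LX≐I-sJ i j = trans (⊗-⟦⟧ laplacianForm groupInverseForm i j)
                        (trans (cong (λ f → ⟦ f ⟧ i j) laplacian·groupInverse) (⟦I-sJ-Form⟧ i j))
    L-centre : ∀ m → m + m * (- 1ℚ) ≡ 0ℚ
    L-centre = solve-∀ ℚ-ring
    L-blade : ∀ m n → - 1ℚ + (0ℚ * m + (- 1ℚ) * n + (n + 1ℚ)) ≡ 0ℚ
    L-blade = solve-∀ ℚ-ring
    X-centre : ∀ m s → m * s * s + m * (- (s * s)) ≡ 0ℚ
    X-centre = solve-∀ ℚ-ring
    X-blade : ∀ m n s p → - (s * s) + ((- (s * s) - s) * m + p * n + p)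
                          ≡ 0ℚ + (- s - 1ℚ) * (s * (1ℚ + m) - 1ℚ) + 1ℚ * (p * (1ℚ + n) - 1ℚ)
    X-blade = solve-∀ ℚ-ring

  resistanceValues : Form
  resistanceValues = form 0ℚ (ℕtoℚ 2 * p) (ℕtoℚ 2 * p) (ℕtoℚ 4 * p) (- (ℕtoℚ 2 * p)) (- (ℕtoℚ 2 * p))

  resistance-groupInverse : resistanceForm groupInverseForm ≡ resistanceValues
  resistance-groupInverse = form-cong refl
    (≡-modulo s s-inverse (centre-blade mℚ s p))
    (≡-modulo s s-inverse (blade-centre mℚ s p))
    (blade-blade s p) refl refl
    where
    centre-blade : ∀ m s p → m * s * s + ((- (s * s) - s) + p + p) - ℕtoℚ 2 * (- (s * s))
                             ≡ ℕtoℚ 2 * p + s * (s * (1ℚ + m) - 1ℚ)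
    centre-blade = solve-∀ ℚ-ring
    blade-centre : ∀ m s p → ((- (s * s) - s) + p + p) + m * s * s - ℕtoℚ 2 * (- (s * s))
                             ≡ ℕtoℚ 2 * p + s * (s * (1ℚ + m) - 1ℚ)
    blade-centre = solve-∀ ℚ-ring
    blade-blade : ∀ s p → ((- (s * s) - s) + p + p) + ((- (s * s) - s) + p + p) - ℕtoℚ 2 * (- (s * s) - s)
                          ≡ ℕtoℚ 4 * p
    blade-blade = solve-∀ ℚ-ring

  numerator-windmill : 1 ≤ t → ℕtoℚ (n ℕ.* n ℕ.* (2 ℕ.* t ℕ.∸ 1)) ≡ ℕtoℚ 2 * mℚ * nℚ - nℚ * nℚ
  numerator-windmill 1≤t = begin
    ℕtoℚ (n ℕ.* n ℕ.* (2 ℕ.* t ℕ.∸ 1))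
      ≡⟨ trans (ℕtoℚ-* (n ℕ.* n) _) (cong₂ _*_ (ℕtoℚ-* n n) (ℕtoℚ-∸ 1≤2t)) ⟩
    nℚ * nℚ * (ℕtoℚ (2 ℕ.* t) - 1ℚ)
      ≡⟨ cong (λ x → nℚ * nℚ * (x - 1ℚ)) (ℕtoℚ-* 2 t) ⟩
    nℚ * nℚ * (ℕtoℚ 2 * ℕtoℚ t - 1ℚ)
      ≡⟨ expand (ℕtoℚ t) nℚ ⟩
    ℕtoℚ 2 * (ℕtoℚ t * nℚ) * nℚ - nℚ * nℚ
      ≡⟨ cong (λ m → ℕtoℚ 2 * m * nℚ - nℚ * nℚ) (ℕtoℚ-* t n) ⟨
    ℕtoℚ 2 * mℚ * nℚ - nℚ * nℚ
      ∎
    where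
    open ≡-Reasoning
    1≤2t : 1 ≤ 2 ℕ.* t
    1≤2t = ℕₚ.m≤n⇒m≤o*n 2 1≤t
    expand : ∀ t n → n * n * (ℕtoℚ 2 * t - 1ℚ) ≡ ℕtoℚ 2 * (t * n) * n - n * n
    expand = solve-∀ ℚ-ring

  four-numEdges-windmill : 4 ℕ.* numEdges G ≡ 2 ℕ.* (M ℕ.* suc n)
  four-numEdges-windmill = trans (ℕₚ.*-assoc 2 2 (numEdges G))
    (cong (2 ℕ.*_) (trans (cong (numEdges G ℕ.+_) (ℕₚ.+-identityʳ (numEdges G))) numEdges-windmill))

  weighted-resistance-⟦⟧ : ∀ i j → ℕtoℚ (degree G i) * ℕtoℚ (degree G j) * resistance ⟦ groupInverseForm ⟧ i j
                                   ≡ ⟦ weigh mℚ nℚ resistanceValues ⟧ i j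
  weighted-resistance-⟦⟧ i j = trans
    (cong₂ _*_ (cong₂ _*_ (degree-windmill i) (degree-windmill j))
               (trans (resistance-⟦⟧ groupInverseForm i j) (cong (λ f → ⟦ f ⟧ i j) resistance-groupInverse)))
    (weigh-⟦⟧ mℚ nℚ resistanceValues i j)

  kemeny-windmill : 1 ≤ t → 1 ≤ n →
                    kemeny G ⟦ groupInverseForm ⟧ ≡ (+ (n ℕ.* n ℕ.* (2 ℕ.* t ℕ.∸ 1))) / suc n
  kemeny-windmill 1≤t 1≤n = begin
    kemeny G ⟦ groupInverseForm ⟧
      ≡⟨ cong₂ (λ k S → recipℕ k * S) four-numEdges-windmill
               (∑-cong (λ i → ∑-cong (weighted-resistance-⟦⟧ i))) ⟩
    recipℕ K * ∑ℚ (λ i → ∑ℚ (⟦ weigh mℚ nℚ resistanceValues ⟧ i))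
      ≡⟨ cong (_*_ (recipℕ K)) (trans (∑∑-⟦⟧ (weigh mℚ nℚ resistanceValues)) (total mℚ nℚ p)) ⟩
    recipℕ K * (ℕtoℚ 2 * (mℚ * (1ℚ + nℚ)) * ((ℕtoℚ 2 * mℚ * nℚ - nℚ * nℚ) * p))
      ≡⟨ cong₂ (λ k v → recipℕ K * (k * (v * p))) ℕtoℚ-K (numerator-windmill 1≤t) ⟨
    recipℕ K * (ℕtoℚ K * V)
      ≡⟨ trans (sym (ℚₚ.*-assoc (recipℕ K) (ℕtoℚ K) V))
               (trans (cong (_* V) (recipℕ-inverse K {{K≢0}})) (ℚₚ.*-identityˡ V)) ⟩
    V
      ≡⟨ /-as-recipℕ (n ℕ.* n ℕ.* (2 ℕ.* t ℕ.∸ 1)) n ⟨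
    (+ (n ℕ.* n ℕ.* (2 ℕ.* t ℕ.∸ 1))) / suc n
      ∎
    where
    open ≡-Reasoning
    K : ℕ
    K = 2 ℕ.* (M ℕ.* suc n)
    K≢0 : NonZero K
    K≢0 = ℕₚ.m*n≢0 2 (M ℕ.* suc n)
            {{_}} {{ℕₚ.m*n≢0 M (suc n) {{ℕₚ.m*n≢0 t n {{ℕ.>-nonZero 1≤t}} {{ℕ.>-nonZero 1≤n}}}}}}
    ℕtoℚ-K : ℕtoℚ K ≡ ℕtoℚ 2 * (mℚ * (1ℚ + nℚ))
    ℕtoℚ-K = trans (ℕtoℚ-* 2 (M ℕ.* suc n))
                   (cong (_*_ (ℕtoℚ 2)) (trans (ℕtoℚ-* M (suc n)) (cong (_*_ mℚ) (ℕtoℚ-+ 1 n))))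
    V : ℚ
    V = ℕtoℚ (n ℕ.* n ℕ.* (2 ℕ.* t ℕ.∸ 1)) * p
    total : ∀ m n p →
      m * m * 0ℚ + m * (m * n * (ℕtoℚ 2 * p))
        + m * (n * m * (ℕtoℚ 2 * p) + (n * n * (ℕtoℚ 4 * p) * m + n * n * (- (ℕtoℚ 2 * p)) * n + n * n * (- (ℕtoℚ 2 * p))))
      ≡ ℕtoℚ 2 * (m * (1ℚ + n)) * ((ℕtoℚ 2 * m * n - n * n) * p)
    total = solve-∀ ℚ-ring

corollary3p2 : (t n : ℕ) → 2 ≤ t → 1 ≤ n →
    (Σ[ X ∈ Matrix (suc (t ℕ.* n)) ] IsGroupInverse (laplacian (windmill t n)) X)
    × ((X : Matrix (suc (t ℕ.* n))) → IsGroupInverse (laplacian (windmill t n)) X →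
         kemeny (windmill t n) X ≡ (+ (n ℕ.* n ℕ.* (2 ℕ.* t ℕ.∸ 1))) / suc n)
corollary3p2 t n 2≤t 1≤n =
    (⟦ groupInverseForm ⟧ , groupInverse)
  , λ X X-inverse → trans (kemeny-cong G (groupInverse-unique X-inverse groupInverse)) (kemeny-windmill 1≤t 1≤n)
  where
  open Windmill t n
  1≤t : 1 ≤ t
  1≤t = ℕₚ.≤-trans (ℕₚ.n≤1+n 1) 2≤t
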